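{- $\vDash_1\subsetneq\vDash_2$.
   Context: Formulas are built from a countable set $PL$ of propositional letters and $\bot$ using $\land,\lor,\to$. For a frame $\mathfrak F=\langle W,R\rangle$, $X\subseteq W$: $\Box_{\mathfrak F}X=\{w\mid\forall v(wRv\Rightarrow v\in X)\}$, $\Diamond_{\mathfrak F}X=W\setminus\Box_{\mathfrak F}(W\setminus X)$, $\Diamond^{ -1}_{\mathfrak F}X=\{w\mid\exists x\in X,\ xRw\}$; $FP_{\mathfrak F}=\{\Box_{\mathfrak F}X\mid X\subseteq W\}$. A $\Box\Diamond^{ -1}$-model is a Kripke model with $V(p)\in FP_{\mathfrak F}$ for every $p$. Truth sets: $\|p\|=V(p)$, $\|\bot\|=\Box_{\mathfrak F}\emptyset$, $\|\alpha\land\beta\|=\|\alpha\|\cap\|\beta\|$, $\|\alpha\to\beta\|=\Box_{\mathfrak F}((W\setminus\|\alpha\|)\cup\|\beta\|)$, $\|\alpha\lor\beta\|=\Box_{\mathfrak F}\Diamond^{ -1}_{\mathfrak F}(\|\alpha\|\cup\|\beta\|)$. A frame is pseudo-reflexive iff every $w\in\Box_{\mathfrak F}\emptyset\cup\Diamond_{\mathfrak F}\Box_{\mathfrak F}\Diamond^{ -1}_{\mathfrak F}\{w\}$ and pseudo-symmetric iff every $w\in\Box_{\mathfrak F}\Diamond_{\mathfrak F}\Box_{\mathfrak F}\Diamond^{ -1}_{\mathfrak F}\{w\}$. $\mathcal D_1$ is the class of pseudo-reflexive pseudo-symmetric $\Box\Diamond^{ -1}$-models, $\mathcal D_2$ the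 class of reflexive pseudo-symmetric $\Box\Diamond^{ -1}$-models, and $\Gamma\vDash_k\varphi$ iff for every $\mathfrak M\in\mathcal D_k$ and $w\in\mathfrak M$, $\mathfrak M,w\vDash\Gamma$ implies $\mathfrak M,w\vDash\varphi$. -}

module Defs where

open import Data.Nat using (ℕ)
open import Data.Product using (Σ; _×_; ∃)
open import Data.Sum using (_⊎_)
open import Data.Empty using (⊥)
open import Relation.Nullary using (¬_)
open import Relation.Binary.PropositionalEquality using (_≡_)

data Fml : Set where
  var  : ℕ → Fml
  bot  : Fml
  _∧'_ : Fml → Fml → Fml
  _∨'_ : Fml → Fml → Fml
  _⇒'_ : Fml → Fml → Fml

record Frame : Set₁ where
  field
    W : Set
    R : W → W → Set

module _ (F : Frame) where
  open Frame F

  Sub : Set₁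
  Sub = W → Set

  □ : Sub → Sub
  □ X w = ∀ v → R w v → X v

  ∅ : Sub
  ∅ _ = ⊥

  compl : Sub → Sub
  compl X w = ¬ X w

  _∪_ : Sub → Sub → Sub
  (X ∪ Y) w = X w ⊎ Y w

  ◇ : Sub → Sub
  ◇ X = compl (□ (compl X))

  ◇⁻ : Sub → Sub
  ◇⁻ X w = Σ W λ x → X x × R x w

  singleton : W → Sub
  singleton w x = x ≡ w

  InFP : Sub → Set₁
  InFP X = Σ Sub λ Y → ∀ w → (X w → □ Y w) × (□ Y w → X w)

  PseudoReflexive : Set
  PseudoReflexive = ∀ w → □ ∅ w ⊎ ◇ (□ (◇⁻ (singleton w))) w

  PseudoSymmetric : Set
  PseudoSymmetric = ∀ w → □ (◇ (□ (◇⁻ (singleton w)))) w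

  Reflexive : Set
  Reflexive = ∀ w → R w w

record Model : Set₁ where
  field
    frame : Frame
    V     : ℕ → Frame.W frame → Set
    V-FP  : ∀ p → InFP frame (V p)

module _ (M : Model) where
  open Model M
  open Frame frame

  ‖_‖ : Fml → Sub frame
  ‖ var p ‖   = V p
  ‖ bot ‖     = □ frame (∅ frame)
  ‖ a ∧' b ‖  = λ w → ‖ a ‖ w × ‖ b ‖ w
  ‖ a ⇒' b ‖  = □ frame (_∪_ frame (compl frame ‖ a ‖) ‖ b ‖)
  ‖ a ∨' b ‖  = □ frame (◇⁻ frame (_∪_ frame ‖ a ‖ ‖ b ‖))

InD₁ : Model → Set
InD₁ M = PseudoReflexive (Model.frame M) × PseudoSymmetric (Model.frame M)

InD₂ : Model → Set
InD₂ M = Reflexive (Model.frame M) × PseudoSymmetric (Model.frame M)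

FmlSet : Set₁
FmlSet = Fml → Set

Conseq : (Model → Set) → FmlSet → Fml → Set₁
Conseq D Γ φ = (M : Model) → D M → (w : Frame.W (Model.frame M)) →
  (∀ γ → Γ γ → ‖ M ‖ γ w) → ‖ M ‖ φ w

_⊨₁_ : FmlSet → Fml → Set₁
Γ ⊨₁ φ = Conseq InD₁ Γ φ

_⊨₂_ : FmlSet → Fml → Set₁
Γ ⊨₂ φ = Conseq InD₂ Γ φ

{-# OPTIONS --safe #-}
-- Reflexivity implies pseudo-reflexivity (w sees w, and w ∈ □◇⁻¹{w} in any
-- frame), so 𝒟₂ ⊆ 𝒟₁ and ⊨₁ ⊆ ⊨₂. Modus ponens {q, q → p} ⊨ p holds in every
-- reflexive model, but fails in 𝒟₁: a world seen by every world and seeing only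
-- itself makes any frame pseudo-reflexive and pseudo-symmetric, and in such a
-- frame a world can see only p-worlds without being a p-world itself.
module Submission where

open import Defs
open import Data.Product using (Σ; _×_; _,_)
open import Data.Sum using (_⊎_; inj₁; inj₂)
open import Data.Unit using (⊤; tt)
open import Data.Nat using (ℕ; zero; suc)
open import Data.Empty using (⊥-elim)
open import Function using (id)
open import Relation.Nullary using (¬_)
open import Relation.Unary using (_⊆′_)
open import Relation.Binary.PropositionalEquality using (_≡_; refl; sym; subst)

Conseq-antitone : ∀ {D D′ : Model → Set} → D ⊆′ D′ → ∀ Γ φ → Conseq D′ Γ φ → Conseq D Γ φ
Conseq-antitone D⊆D′ _ _ h M M∈D = h M (D⊆D′ M M∈D)

module _ (F : Frame) where
  open Frame F

  ∈□◇⁻-singleton : ∀ w → □ F (◇⁻ F (singleton F w)) w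
  ∈□◇⁻-singleton w v wRv = w , refl , wRv

  reflexive⇒pseudoReflexive : Reflexive F → PseudoReflexive F
  reflexive⇒pseudoReflexive refl-R w = inj₂ (λ h → h w (refl-R w) (∈□◇⁻-singleton w))

  module _ (s : W) (sees-s : ∀ w → R w s) (s-sees-only-s : ∀ {v} → R s v → v ≡ s) where

    sink∈□◇⁻-singleton : ∀ w → □ F (◇⁻ F (singleton F w)) s
    sink∈□◇⁻-singleton w v sRv = w , refl , subst (R w) (sym (s-sees-only-s sRv)) (sees-s w)

    sink⇒pseudoReflexive : PseudoReflexive F
    sink⇒pseudoReflexive w = inj₂ (λ h → h s (sees-s w) (sink∈□◇⁻-singleton w))

    sink⇒pseudoSymmetric : PseudoSymmetric F
    sink⇒pseudoSymmetric w v _ h = h s (sees-s v) (sink∈□◇⁻-singleton w)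

D₂⊆D₁ : InD₂ ⊆′ InD₁
D₂⊆D₁ M (refl-R , pseudoSym) = reflexive⇒pseudoReflexive (Model.frame M) refl-R , pseudoSym

⇒'-elim-reflexive : ∀ M → Reflexive (Model.frame M) → ∀ α β w →
  ‖ M ‖ (α ⇒' β) w → ‖ M ‖ α w → ‖ M ‖ β w
⇒'-elim-reflexive M refl-R _ _ w α⇒β α with α⇒β w (refl-R w)
... | inj₁ ¬α = ⊥-elim (¬α α)
... | inj₂ β  = β

⟅_,_⟆ : Fml → Fml → FmlSet
⟅ α , β ⟆ γ = γ ≡ α ⊎ γ ≡ β

modusPonens-⊨₂ : ∀ α β → ⟅ α , α ⇒' β ⟆ ⊨₂ β
modusPonens-⊨₂ α β M (refl-R , _) w sat =
  ⇒'-elim-reflexive M refl-R α β w (sat (α ⇒' β) (inj₂ refl)) (sat α (inj₁ refl))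

-- a is the sink; modus ponens fails at b because of its successor c.
data World : Set where
  a b c : World

data _⟶_ : World → World → Set where
  a⟶a : a ⟶ a
  b⟶a : b ⟶ a
  b⟶c : b ⟶ c
  c⟶a : c ⟶ a

sinkFrame : Frame
sinkFrame = record { W = World ; R = _⟶_ }

⟶a : ∀ w → w ⟶ a
⟶a a = a⟶a
⟶a b = b⟶a
⟶a c = c⟶a

a⟶only-a : ∀ {v} → a ⟶ v → v ≡ a
a⟶only-a a⟶a = refl

-- p = var 0 is true exactly on □{a}, q = var 1 everywhere.
boxed : ℕ → World → Set
boxed zero    w = w ≡ a
boxed (suc _) _ = ⊤

sinkModel : Model
sinkModel = record
  { frame = sinkFrame
  ; V     = λ p → □ sinkFrame (boxed p)
  ; V-FP  = λ p → boxed p , λ _ → id , id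
  }

sinkModel∈D₁ : InD₁ sinkModel
sinkModel∈D₁ = sink⇒pseudoReflexive sinkFrame a ⟶a a⟶only-a
             , sink⇒pseudoSymmetric sinkFrame a ⟶a a⟶only-a

b⊨⟅q,q⇒p⟆ : ∀ γ → ⟅ var 1 , var 1 ⇒' var 0 ⟆ γ → ‖ sinkModel ‖ γ b
b⊨⟅q,q⇒p⟆ _ (inj₁ refl) _ _ = tt
b⊨⟅q,q⇒p⟆ _ (inj₂ refl) _ b⟶v = inj₂ (λ _ → b⟶²only-a b⟶v)
  where
  b⟶²only-a : ∀ {v u} → b ⟶ v → v ⟶ u → u ≡ a
  b⟶²only-a b⟶a a⟶a = refl
  b⟶²only-a b⟶c c⟶a = refl

b⊭p : ¬ ‖ sinkModel ‖ (var 0) b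
b⊭p b⊨p with b⊨p c b⟶c
... | ()

modusPonens-⊭₁ : ¬ (⟅ var 1 , var 1 ⇒' var 0 ⟆ ⊨₁ var 0)
modusPonens-⊭₁ h = b⊭p (h sinkModel sinkModel∈D₁ b b⊨⟅q,q⇒p⟆)

lemma2 : ((Γ : FmlSet) (φ : Fml) → Γ ⊨₁ φ → Γ ⊨₂ φ)
    × Σ FmlSet (λ Γ → Σ Fml (λ φ → (Γ ⊨₂ φ) × ¬ (Γ ⊨₁ φ)))
lemma2 = Conseq-antitone D₂⊆D₁
       , ⟅ var 1 , var 1 ⇒' var 0 ⟆ , var 0 , modusPonens-⊨₂ (var 1) (var 0) , modusPonens-⊭₁
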